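{- Let $z=(z_1,\dots,z_k)$ be a vector of $2\le k\le\Delta-1$ nonnegative integers with $z_i\le r-1$, and let $s\in\{1,\dots,k\}$. Then $\Pi(z,s)$ cannot be solved in $0$ rounds in the deterministic port numbering model; that is, there is no sequence $(a_1,\dots,a_\Delta)$ of labels of $\Pi(z,s)$ whose multiset lies in the node constraint of $\Pi(z,s)$ such that, for every choice of (not necessarily distinct) ports $p_1,\dots,p_r\in\{1,\dots,\Delta\}$, the multiset $\{a_{p_1},\dots,a_{p_r}\}$ lies in the hyperedge constraint of $\Pi(z,s)$.
   Context: Fix integers $\Delta\ge3$, $r\ge3$. Let $\mathfrak{C}(z)=\{1,\dots,k\}$. The problem $\Pi(z,s)$ has labels $\mathsf{D},\mathsf{M},\mathsf{P},\mathsf{U},\mathsf{X}$ and $\ell(\mathcal{C})$ for each nonempty $\mathcal{C}\subseteq\mathfrak{C}(z)$. Node constraint (multisets of size $\Delta$, exponents are multiplicities): $\mathsf{M}^\Delta$; $\mathsf{P}\,\mathsf{U}^{\Delta-1}$; $\mathsf{D}^{\Delta-1}\mathsf{X}$; and $\ell(\mathcal{C})^{\Delta-|\mathcal{C}|+1}\mathsf{U}^{|\mathcal{C}|-1}$ for each nonempty $\mathcal{C}\subseteq\mathfrak{C}(z)$. Hyperedge constraint: all multisets $L_1\dots L_r$ satisfying at least one of: (1) some $L_j=\mathsf{M}$ and $L_{j'}\notin\{\mathsf{D},\mathsf{M}\}$ for all $j'\ne j$; (2) there are distinct $j,j'$ with $L_j=\mathsf{X}$, $L_{j'}$ arbitrary,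 and $L_{j''}\notin\{\mathsf{D},\mathsf{M}\}$ for all other $j''$; (3) all of: (a) no $L_j$ equals $\mathsf{P}$; (b) at most one $L_j$ lies in $\{\mathsf{D},\mathsf{M}\}$; (c) at most $z_s$ indices $j$ have $L_j=\mathsf{D}$ or $L_j=\ell(\mathcal{C})$ with $s\in\mathcal{C}$; (d) for each $i\in\mathfrak{C}(z)\setminus\{s\}$, at most $z_i$ indices $j$ have $L_j=\ell(\mathcal{C})$ with $i\in\mathcal{C}$. -}

module Defs where

open import Data.Nat using (ℕ; zero; suc; _+_; _∸_; _≤_)
open import Data.Bool using (Bool; true; false; _∨_; if_then_else_)
open import Data.Fin using (Fin; zero; suc)
open import Data.Fin.Subset using (Subset; Nonempty; _∈_; ∣_∣)
open import Data.Fin.Subset.Properties using (_∈?_)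
open import Data.Vec.Properties using (≡-dec)
import Data.Bool.Properties as BoolP
open import Data.Product using (Σ; ∃; ∃-syntax; _×_; _,_)
open import Data.Sum using (_⊎_)
open import Relation.Nullary using (¬_; does)
open import Relation.Binary.PropositionalEquality using (_≡_; _≢_)

-- Colour set 𝔆(z) = {1,…,k} is represented 0-indexed by Fin k.
-- The nonemptiness proof is an irrelevant argument, so ℓ C p ≡ ℓ C q.
data Label (k : ℕ) : Set where
  D M P U X : Label k
  ℓ : (C : Subset k) → .(Nonempty C) → Label k

count : ∀ {n} → (Fin n → Bool) → ℕ
count {zero}  f = 0
count {suc n} f = (if f zero then 1 else 0) + count (λ j → f (suc j))

module _ {k : ℕ} where
  isD isM isP isU isX isDM : Label k → Bool
  isD D = true
  isD _ = false
  isM M = true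
  isM _ = false
  isP P = true
  isP _ = false
  isU U = true
  isU _ = false
  isX X = true
  isX _ = false
  isDM D = true
  isDM M = true
  isDM _ = false

  isℓ : Subset k → Label k → Bool
  isℓ C (ℓ C' _) = does (≡-dec BoolP._≟_ C' C)
  isℓ C _ = false

  hasColour : Fin k → Label k → Bool
  hasColour i (ℓ C _) = does (i ∈? C)
  hasColour i _ = false

  isDorColour : Fin k → Label k → Bool
  isDorColour i l = isD l ∨ hasColour i l

-- Node constraint of Π(z,s) on a sequence a₁…a_Δ: its multiset is one of
--   M^Δ ; P U^(Δ-1) ; D^(Δ-1) X ; ℓ(C)^(Δ-|C|+1) U^(|C|-1) (C nonempty).
-- Multiset equality is written out via multiplicities (they sum to Δ).
NodeConstraint : (Δ k : ℕ) → (Fin Δ → Label k) → Set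
NodeConstraint Δ k a =
    (∀ j → a j ≡ M)
  ⊎ (count (λ j → isP (a j)) ≡ 1 × count (λ j → isU (a j)) ≡ Δ ∸ 1)
  ⊎ (count (λ j → isD (a j)) ≡ Δ ∸ 1 × count (λ j → isX (a j)) ≡ 1)
  ⊎ (∃[ C ] (Nonempty C
        × count (λ j → isℓ C (a j)) ≡ Δ ∸ ∣ C ∣ + 1
        × count (λ j → isU (a j)) ≡ ∣ C ∣ ∸ 1))

-- Hyperedge constraint of Π(z,s) on a sequence L₁…L_r (conditions are
-- symmetric in the indices, so this is a condition on the multiset).
HyperedgeConstraint : (r k : ℕ) → (z : Fin k → ℕ) → (s : Fin k) →
                      (Fin r → Label k) → Set
HyperedgeConstraint r k z s L =
    (∃[ j ] (L j ≡ M × (∀ j' → j' ≢ j → isDM (L j') ≡ false)))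
  ⊎ (∃[ j ] ∃[ j' ] (j ≢ j' × L j ≡ X
        × (∀ j'' → j'' ≢ j → j'' ≢ j' → isDM (L j'') ≡ false)))
  ⊎ ((∀ j → L j ≢ P)
     × count (λ j → isDM (L j)) ≤ 1
     × count (λ j → isDorColour s (L j)) ≤ z s
     × (∀ i → i ≢ s → count (λ j → hasColour i (L j)) ≤ z i))

ZeroRoundSolvable : (Δ r k : ℕ) → (z : Fin k → ℕ) → (s : Fin k) → Set
ZeroRoundSolvable Δ r k z s =
  Σ (Fin Δ → Label k) λ a →
    NodeConstraint Δ k a
    × (∀ (p : Fin r → Fin Δ) → HyperedgeConstraint r k z s (λ j → a (p j)))

module Submission where

open import Defs
open import Data.Nat using (ℕ; zero; suc; _≤_; _∸_; s≤s)
open import Data.Nat.Properties using (+-comm; ≤-trans; n≤1+n; <-irrefl; <⇒≱)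
open import Data.Bool using (Bool; true; false)
open import Data.Fin using (Fin; zero; suc; punchIn; _≟_)
open import Data.Fin.Properties using (punchInᵢ≢i)
open import Data.Fin.Subset using (Nonempty; ∣_∣)
open import Data.Fin.Subset.Properties using (_∈?_)
open import Data.Vec.Properties using (≡-dec)
import Data.Bool.Properties as BoolP
open import Data.Product using (∃-syntax; _,_)
open import Data.Sum using (inj₁; inj₂)
open import Relation.Nullary using (¬_; yes; no)
open import Relation.Nullary.Decidable using (dec-true)
open import Relation.Binary.PropositionalEquality using (_≡_; refl; sym; trans; cong; subst)

-- A 0-round algorithm fixes one output sequence a, and routing all r ports of
-- a hyperedge to the same port j gives the constant multiset (a j)^r.  Every
-- node configuration contains a label M, P, D or ℓ(C), and none of these can
-- fill a hyperedge: M^r and D^r hold more than one label of {D, M}, P^r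
-- contains P, and ℓ(C)^r carries a colour i ∈ C on r > z_i labels.

count-const : ∀ n {b} → b ≡ true → count {n} (λ _ → b) ≡ n
count-const zero    _    = refl
count-const (suc n) refl = cong suc (count-const n refl)

count-const-≤ : ∀ {n b m} → b ≡ true → count {n} (λ _ → b) ≤ m → n ≤ m
count-const-≤ {n} b≡true = subst (_≤ _) (count-const n b≡true)

count≡suc⇒∃ : ∀ {n m} (f : Fin n → Bool) → count f ≡ suc m → ∃[ j ] f j ≡ true
count≡suc⇒∃ {suc n} f eq with f zero in f0≡b
... | true  = zero , f0≡b
... | false with count≡suc⇒∃ (λ j → f (suc j)) eq
...   | j , fj≡true = suc j , fj≡true

data Rigid {k : ℕ} : Label k → Set where
  M-rigid : Rigid M
  P-rigid : Rigid P
  D-rigid : Rigid D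
  ℓ-rigid : ∀ {C} .{q : Nonempty C} → Nonempty C → Rigid (ℓ C q)

module _ {k : ℕ} where

  isP⇒rigid : ∀ {l : Label k} → isP l ≡ true → Rigid l
  isP⇒rigid {P} _ = P-rigid

  isD⇒rigid : ∀ {l : Label k} → isD l ≡ true → Rigid l
  isD⇒rigid {D} _ = D-rigid

  isℓ⇒rigid : ∀ {C} {l : Label k} → Nonempty C → isℓ C l ≡ true → Rigid l
  isℓ⇒rigid {C} {ℓ C′ _} ne e with ≡-dec BoolP._≟_ C′ C
  ... | yes refl = ℓ-rigid ne

  node-constraint⇒rigid : ∀ {Δ} {a : Fin Δ → Label k} → 2 ≤ Δ →
                          NodeConstraint Δ k a → ∃[ j ] Rigid (a j)
  node-constraint⇒rigid {suc Δ} _ (inj₁ allM) =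
    zero , subst Rigid (sym (allM zero)) M-rigid
  node-constraint⇒rigid {a = a} _ (inj₂ (inj₁ (#P≡1 , _)))
    with j , e ← count≡suc⇒∃ (λ j → isP (a j)) #P≡1 = j , isP⇒rigid e
  node-constraint⇒rigid {a = a} (s≤s (s≤s _)) (inj₂ (inj₂ (inj₁ (#D≡Δ-1 , _))))
    with j , e ← count≡suc⇒∃ (λ j → isD (a j)) #D≡Δ-1 = j , isD⇒rigid e
  node-constraint⇒rigid {Δ} {a} _ (inj₂ (inj₂ (inj₂ (C , ne , #ℓ≡Δ-∣C∣+1 , _))))
    with j , e ← count≡suc⇒∃ (λ j → isℓ C (a j)) (trans #ℓ≡Δ-∣C∣+1 (+-comm (Δ ∸ ∣ C ∣) 1))
    = j , isℓ⇒rigid ne e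

  rigid-fills-no-hyperedge :
    ∀ {r} {z : Fin k → ℕ} {s} {L : Label k} → 3 ≤ r → (∀ i → z i ≤ r ∸ 1) →
    Rigid L → ¬ HyperedgeConstraint r k z s (λ _ → L)
  rigid-fills-no-hyperedge (s≤s (s≤s _)) _ M-rigid (inj₁ (j , _ , others⇏DM))
    with () ← others⇏DM (punchIn j zero) (punchInᵢ≢i j zero)
  rigid-fills-no-hyperedge 3≤r _ M-rigid (inj₂ (inj₂ (_ , #DM≤1 , _))) =
    <⇒≱ (≤-trans (n≤1+n 2) 3≤r) (count-const-≤ refl #DM≤1)
  rigid-fills-no-hyperedge 3≤r _ D-rigid (inj₂ (inj₂ (_ , #DM≤1 , _))) =
    <⇒≱ (≤-trans (n≤1+n 2) 3≤r) (count-const-≤ refl #DM≤1)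
  rigid-fills-no-hyperedge (s≤s _) _ P-rigid (inj₂ (inj₂ (≢P , _))) = ≢P zero refl
  rigid-fills-no-hyperedge {s = s} (s≤s _) z≤r-1 (ℓ-rigid {C} (i , i∈C))
                           (inj₂ (inj₂ (_ , _ , #s≤zs , #i≤zi))) with i ≟ s
  ... | yes refl = <-irrefl refl
                     (≤-trans (count-const-≤ (dec-true (i ∈? C) i∈C) #s≤zs) (z≤r-1 i))
  ... | no i≢s   = <-irrefl refl
                     (≤-trans (count-const-≤ (dec-true (i ∈? C) i∈C) (#i≤zi i i≢s)) (z≤r-1 i))

lemma23 : (Δ r k : ℕ) → 3 ≤ Δ → 3 ≤ r → 2 ≤ k → k ≤ Δ ∸ 1 →
          (z : Fin k → ℕ) → (∀ i → z i ≤ r ∸ 1) → (s : Fin k) →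
          ¬ ZeroRoundSolvable Δ r k z s
lemma23 Δ r k 3≤Δ 3≤r _ _ z z≤r-1 s (a , node , hyperedge)
  with j , ρ ← node-constraint⇒rigid (≤-trans (n≤1+n 2) 3≤Δ) node
  = rigid-fills-no-hyperedge 3≤r z≤r-1 ρ (hyperedge (λ _ → j))
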